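{- Every split graph $G$ has bandwidth at most $\Delta(G)(\Delta(G)+2)$. Moreover, for every integer $\Delta\ge 2$ there is a split graph $G$ with $\Delta(G)=\Delta$ whose bandwidth is at least $\Delta^2/12$.
   Context: Graphs are finite, simple and undirected; $\Delta(G)$ is the maximum degree. $G$ is a split graph if $V(G)=K\cup I$ where $K$ induces a complete subgraph and $I$ is an independent set. For a vertex ordering (total order) $(v_1,\dots,v_n)$ of $V(G)$, the width of an edge $v_iv_j$ is $|i-j|$ and the width of the ordering is the maximum width of an edge (taken as $0$ if there are no edges); the bandwidth of $G$ is the minimum width over all vertex orderings. -}

module Defs where

open import Data.Nat using (ℕ; _≤_; _⊔_)
open import Data.Fin using (Fin; toℕ)
open import Data.List using (length; filter; foldr; map; allFin)
open import Data.Product using (Σ; _×_)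
open import Relation.Nullary using (¬_)
open import Relation.Binary using (Decidable)
open import Relation.Binary.PropositionalEquality using (_≡_)
open import Data.Fin.Permutation using (Permutation′; _⟨$⟩ʳ_)

record Graph : Set₁ where
  field
    n      : ℕ
    Adj    : Fin n → Fin n → Set
    adj?   : Decidable Adj
    sym    : ∀ {u v} → Adj u v → Adj v u
    irrefl : ∀ {v} → ¬ Adj v v
open Graph public

degree : (G : Graph) → Fin (n G) → ℕ
degree G v = length (filter (adj? G v) (allFin (n G)))

maxDegree : Graph → ℕ
maxDegree G = foldr _⊔_ 0 (map (degree G) (allFin (n G)))

IsSplit : Graph → Set₁
IsSplit G = Σ (Fin (n G) → Set) λ K →
  (∀ u v → K u → K v → ¬ (u ≡ v) → Adj G u v) ×
  (∀ u v → ¬ K u → ¬ K v → ¬ Adj G u v)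

dist : ℕ → ℕ → ℕ
dist a b = (a ∸ b) ⊔ (b ∸ a)
  where open import Data.Nat using (_∸_)

-- A vertex ordering is a permutation σ of Fin n; vertex v gets position σ v.
-- Width of the ordering ≤ k: every edge uv has |σ u - σ v| ≤ k.
WidthAtMost : (G : Graph) → Permutation′ (n G) → ℕ → Set
WidthAtMost G σ k = ∀ u v → Adj G u v → dist (toℕ (σ ⟨$⟩ʳ u)) (toℕ (σ ⟨$⟩ʳ v)) ≤ k

BandwidthAtMost : Graph → ℕ → Set
BandwidthAtMost G k = Σ (Permutation′ (n G)) λ σ → WidthAtMost G σ k

{-# OPTIONS --safe #-}
-- Upper bound: every edge has an endpoint c in the clique, and every non-isolated vertex x
-- is adjacent to c or to a neighbour of c (x or a neighbour of x lies in the clique, so it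
-- equals or is adjacent to c).  Hence at most (1 + Δ)Δ vertices are non-isolated, and an
-- ordering listing them first has width below (1 + Δ)Δ ≤ Δ(Δ + 2).
--
-- Lower bound: the clique K_a with b pendant leaves at each vertex is split, of maximum
-- degree Δ = (a - 1) + b, and any two vertices are joined by a walk leaf–hub–hub–leaf.
-- So an ordering of width k spans at most 3k positions: a + ab - 1 ≤ 3k.  Taking
-- a - 1 and b as close to Δ/2 as possible gives Δ² ≤ 4(a - 1 + ab) ≤ 12k.
module Submission where

open import Defs hiding (sym)
open import Level using (Level; 0ℓ)
open import Function using (_∘_)
open import Data.Nat using (ℕ; zero; suc; _≤_; _<_; _+_; _*_; _∸_; _⊔_; _⊓_; z≤n; s≤s; s≤s⁻¹; z<s; s<s; _≤?_; _<?_; _≟_; ⌊_/2⌋; ⌈_/2⌉)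
open import Data.Nat.Properties
open import Data.Nat.Tactic.RingSolver using (solve-∀)
open import Data.Fin using (Fin; zero; suc; toℕ; fromℕ; fromℕ<; punchIn)
open import Data.Fin.Properties using (toℕ-injective; toℕ<n; toℕ-fromℕ; toℕ-fromℕ<) renaming (any? to anyᶠ?; _≟_ to _≟ᶠ_)
open import Data.Fin.Permutation using (Permutation′; _⟨$⟩ʳ_; _⟨$⟩ˡ_; inverseʳ; lift₀; insert; insert-punchIn)
import Data.Fin.Permutation as Perm
open import Data.List using (List; []; _∷_; length; filter; allFin; tabulate)
open import Data.List.Properties using (filter-accept; filter-reject; filter-≐; filter-none; foldr-preservesᵇ; foldr-preservesᵒ)
open import Data.List.Membership.Propositional using (_∈_; lose)
open import Data.List.Membership.Propositional.Properties using (∈-allFin; ∈-filter⁺)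
import Data.List.Relation.Unary.Any.Properties as Anyₚ
import Data.List.Relation.Unary.All.Properties as Allₚ
open import Data.List.Relation.Unary.Any using (Any; here; there; any?)
import Data.List.Relation.Unary.All as All
open import Data.List.Relation.Binary.Sublist.Propositional using (⊆-refl)
open import Data.List.Relation.Binary.Sublist.Propositional.Properties using (filter⁺; length-mono-≤)
open import Data.Product using (Σ; ∃-syntax; _×_; _,_; proj₁; proj₂)
open import Data.Sum using (_⊎_; inj₁; inj₂)
open import Data.Empty using (⊥-elim)
open import Relation.Nullary using (¬_; Dec; yes; no)
open import Relation.Nullary.Decidable using (decidable-stable; _×-dec_; _⊎-dec_; ¬?)
open import Relation.Unary using (Pred; Decidable; _⊆_; _∪_; _≐_)
open import Relation.Unary.Properties using (_∪?_)
open import Relation.Binary.Definitions using (tri<; tri≈; tri>)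
open import Relation.Binary.Construct.Closure.Reflexive using (ReflClosure; refl; [_])
import Relation.Binary.Construct.Closure.Reflexive.Properties as ReflClosureₚ
open import Relation.Binary.PropositionalEquality using (_≡_; _≢_; refl; sym; trans; cong; subst; module ≡-Reasoning)

private
  variable
    ℓ ℓ′ : Level
    A : Set ℓ
    m : ℕ

count : {P : Pred (Fin m) ℓ} → Decidable P → ℕ
count {m = m} P? = length (filter P? (allFin m))

module _ {P : Pred A ℓ} {Q : Pred A ℓ′} (P? : Decidable P) (Q? : Decidable Q) where

  length-filter-∪ : ∀ xs → length (filter (P? ∪? Q?) xs) ≤ length (filter P? xs) + length (filter Q? xs)
  length-filter-∪ [] = z≤n
  length-filter-∪ (x ∷ xs) with P? x | Q? x
  ... | yes _ | yes _ = s≤s (≤-trans (length-filter-∪ xs) (+-monoʳ-≤ _ (n≤1+n _)))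
  ... | yes _ | no  _ = s≤s (length-filter-∪ xs)
  ... | no  _ | yes _ = ≤-trans (s≤s (length-filter-∪ xs)) (≤-reflexive (sym (+-suc _ _)))
  ... | no  _ | no  _ = length-filter-∪ xs

module _ {P : Pred (Fin m) ℓ} {Q : Pred (Fin m) ℓ′} (P? : Decidable P) (Q? : Decidable Q) where

  count-mono : P ⊆ Q → count P? ≤ count Q?
  count-mono P⊆Q = length-mono-≤ (filter⁺ P? Q? (λ { refl → P⊆Q }) (⊆-refl {x = allFin m}))

  count-≐ : P ≐ Q → count P? ≡ count Q?
  count-≐ P≐Q = cong length (filter-≐ P? Q? P≐Q (allFin m))

  count-∪ : count (P? ∪? Q?) ≤ count P? + count Q?
  count-∪ = length-filter-∪ P? Q? (allFin m)

length-filter-tabulate : {P : Pred A ℓ} (P? : Decidable P) (f : Fin m → A) →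
                         length (filter P? (tabulate f)) ≡ count (P? ∘ f)
length-filter-tabulate {m = zero}  P? f = refl
length-filter-tabulate {m = suc m} P? f with P? (f zero)
... | yes _ = cong suc (trans (length-filter-tabulate P? (f ∘ suc)) (sym (length-filter-tabulate (P? ∘ f) suc)))
... | no  _ = trans (length-filter-tabulate P? (f ∘ suc)) (sym (length-filter-tabulate (P? ∘ f) suc))

module _ {P : Pred (Fin (suc m)) ℓ} (P? : Decidable P) where

  count-accept : P zero → count P? ≡ suc (count (P? ∘ suc))
  count-accept p = trans (cong length (filter-accept P? p)) (cong suc (length-filter-tabulate P? suc))

  count-reject : ¬ P zero → count P? ≡ count (P? ∘ suc)
  count-reject ¬p = trans (cong length (filter-reject P? ¬p)) (length-filter-tabulate P? suc)

count-Any : {R : A → Pred (Fin m) ℓ} (R? : ∀ y → Decidable (R y)) {D : ℕ} →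
            (∀ y → count (R? y) ≤ D) →
            ∀ ys → count (λ x → any? (λ y → R? y x) ys) ≤ length ys * D
count-Any {m = m} R? bound [] = ≤-reflexive (cong length
  (filter-none (λ x → any? (λ y → R? y x) []) (All.universal (λ _ ()) (allFin m))))
count-Any {R = R} R? {D} bound (y ∷ ys) = begin
  count (any-R? (y ∷ ys))          ≤⟨ count-mono (any-R? (y ∷ ys)) (R? y ∪? any-R? ys) split ⟩
  count (R? y ∪? any-R? ys)        ≤⟨ count-∪ (R? y) (any-R? ys) ⟩
  count (R? y) + count (any-R? ys) ≤⟨ +-mono-≤ (bound y) (count-Any R? bound ys) ⟩
  D + length ys * D                ∎
  where
  open ≤-Reasoning
  any-R? : ∀ ys → Decidable (λ x → Any (λ y → R y x) ys)
  any-R? ys x = any? (λ y → R? y x) ys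
  split : ∀ {x} → Any (λ y → R y x) (y ∷ ys) → R y x ⊎ Any (λ y → R y x) ys
  split (here r)  = inj₁ r
  split (there a) = inj₂ a

position : Permutation′ m → Fin m → ℕ
position σ v = toℕ (σ ⟨$⟩ʳ v)

position-⟨$⟩ˡ : ∀ (σ : Permutation′ m) i → position σ (σ ⟨$⟩ˡ i) ≡ toℕ i
position-⟨$⟩ˡ σ i = cong toℕ (inverseʳ σ)

toℕ-punchIn-fromℕ : (j : Fin m) → toℕ (punchIn (fromℕ m) j) ≡ toℕ j
toℕ-punchIn-fromℕ zero    = refl
toℕ-punchIn-fromℕ (suc j) = cong suc (toℕ-punchIn-fromℕ j)

moveToFront : {P : Pred (Fin m) ℓ} (P? : Decidable P) →
              Σ (Permutation′ m) λ σ → ∀ v → P v → position σ v < count P?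
moveToFront {m = zero}  P? = Perm.id , λ ()
moveToFront {m = suc m} {P = P} P? = extend (P? zero)
  where
  π : Permutation′ m
  π = proj₁ (moveToFront (P? ∘ suc))
  π-front : ∀ v → P (suc v) → position π v < count (P? ∘ suc)
  π-front = proj₂ (moveToFront (P? ∘ suc))

  extend : Dec (P zero) → Σ (Permutation′ (suc m)) λ σ → ∀ v → P v → position σ v < count P?
  extend (yes p₀) = lift₀ π , λ v p → subst (position (lift₀ π) v <_) (sym (count-accept P? p₀)) (lifted v p)
    where
    lifted : ∀ v → P v → position (lift₀ π) v < suc (count (P? ∘ suc))
    lifted zero    _ = z<s
    lifted (suc v) p = s<s (π-front v p)
  extend (no ¬p₀) = insert zero (fromℕ m) π , inserted
    where
    inserted : ∀ v → P v → position (insert zero (fromℕ m) π) v < count P?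
    inserted zero    p = ⊥-elim (¬p₀ p)
    inserted (suc v) p = begin-strict
      position (insert zero (fromℕ m) π) (suc v) ≡⟨ cong toℕ (insert-punchIn zero (fromℕ m) π v) ⟩
      toℕ (punchIn (fromℕ m) (π ⟨$⟩ʳ v))         ≡⟨ toℕ-punchIn-fromℕ (π ⟨$⟩ʳ v) ⟩
      position π v                                <⟨ π-front v p ⟩
      count (P? ∘ suc)                            ≡⟨ count-reject P? ¬p₀ ⟨
      count P?                                    ∎
      where open ≤-Reasoning

dist≤ : ∀ {a b k} → a ≤ k → b ≤ k → dist a b ≤ k
dist≤ {a} {b} a≤k b≤k = ⊔-lub (≤-trans (m∸n≤m a b) a≤k) (≤-trans (m∸n≤m b a) b≤k)

module _ (G : Graph) where

  neighbours : Fin (n G) → List (Fin (n G))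
  neighbours v = filter (adj? G v) (allFin (n G))

  NonIsolated : Pred (Fin (n G)) 0ℓ
  NonIsolated v = ∃[ w ] Adj G v w

  nonIsolated? : Decidable NonIsolated
  nonIsolated? v = anyᶠ? (adj? G v)

  degree≤maxDegree : ∀ v → degree G v ≤ maxDegree G
  degree≤maxDegree v = foldr-preservesᵒ ⊔-keeps 0 _ (inj₂ (Anyₚ.map⁺ (lose (∈-allFin v) ≤-refl)))
    where
    ⊔-keeps : ∀ x y → degree G v ≤ x ⊎ degree G v ≤ y → degree G v ≤ x ⊔ y
    ⊔-keeps x y (inj₁ ≤x) = m≤n⇒m≤n⊔o y ≤x
    ⊔-keeps x y (inj₂ ≤y) = m≤n⇒m≤o⊔n x ≤y

  maxDegree-lub : ∀ {D} → (∀ v → degree G v ≤ D) → maxDegree G ≤ D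
  maxDegree-lub {D} bound = foldr-preservesᵇ {P = _≤ D} ⊔-lub z≤n (Allₚ.map⁺ (Allₚ.tabulate⁺ bound))

position-step : ∀ (G : Graph) (σ : Permutation′ (n G)) {k} → WidthAtMost G σ k →
                ∀ {u v} → ReflClosure (Adj G) u v → position σ v ≤ position σ u + k
position-step G σ {k} width {u} refl = m≤m+n (position σ u) k
position-step G σ {k} width {u} {v} [ uv ] = begin
  position σ v
    ≤⟨ m≤n+m∸n (position σ v) (position σ u) ⟩
  position σ u + (position σ v ∸ position σ u)
    ≤⟨ +-monoʳ-≤ (position σ u) (≤-trans (m≤n⊔m _ _) (width u v uv)) ⟩
  position σ u + k ∎
  where open ≤-Reasoning

module SplitGraph (G : Graph) (split : IsSplit G) where

  K : Fin (n G) → Set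
  K = proj₁ split

  clique : ∀ u v → K u → K v → ¬ u ≡ v → Adj G u v
  clique = proj₁ (proj₂ split)

  independent : ∀ u v → ¬ K u → ¬ K v → ¬ Adj G u v
  independent = proj₂ (proj₂ split)

  clique-step : ∀ {u v} → K u → K v → ReflClosure (Adj G) u v
  clique-step {u} {v} ku kv with u ≟ᶠ v
  ... | yes refl = refl
  ... | no  u≢v  = [ clique u v ku kv u≢v ]

  -- IsSplit does not make K decidable, but the goals here are, so we may split on K x ⊎ K y under ¬¬.
  nonIsolated-near : ∀ {c c′ x} → K c → Adj G c c′ → NonIsolated G x →
                     Any (λ y → Adj G y x) (c ∷ neighbours G c)
  nonIsolated-near {c} {c′} {x} kc cc′ (y , xy) =
    decidable-stable (any? (λ z → adj? G z x) (c ∷ neighbours G c))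
      λ ¬near → independent x y (¬near ∘ viaX) (¬near ∘ viaY) xy
    where
    neighbour : ∀ {z} → Adj G c z → z ∈ neighbours G c
    neighbour {z} cz = ∈-filter⁺ (adj? G c) (∈-allFin z) cz
    viaX : K x → Any (λ y → Adj G y x) (c ∷ neighbours G c)
    viaX kx with x ≟ᶠ c
    ... | yes refl = there (lose (neighbour cc′) (Graph.sym G cc′))
    ... | no  x≢c  = here (clique c x kc kx (x≢c ∘ sym))
    viaY : K y → Any (λ y → Adj G y x) (c ∷ neighbours G c)
    viaY ky with y ≟ᶠ c
    ... | yes refl = here (Graph.sym G xy)
    ... | no  y≢c  = there (lose (neighbour (clique c y kc ky (y≢c ∘ sym))) (Graph.sym G xy))

  spread≤3k : (∀ u → ∃[ h ] K h × ReflClosure (Adj G) u h) →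
              ∀ σ {k} → WidthAtMost G σ k → ∀ u v → position σ v ≤ position σ u + k + k + k
  spread≤3k near σ {k} width u v
    with uₕ , uₕ∈K , u-near ← near u | vₕ , vₕ∈K , v-near ← near v = begin
    position σ v             ≤⟨ step (ReflClosureₚ.sym (Graph.sym G) v-near) ⟩
    position σ vₕ + k        ≤⟨ +-monoˡ-≤ k (step (clique-step uₕ∈K vₕ∈K)) ⟩
    position σ uₕ + k + k    ≤⟨ +-monoˡ-≤ k (+-monoˡ-≤ k (step u-near)) ⟩
    position σ u + k + k + k ∎
    where
    open ≤-Reasoning
    step : ∀ {u v} → ReflClosure (Adj G) u v → position σ v ≤ position σ u + k
    step = position-step G σ width

  private
    Δ : ℕ
    Δ = maxDegree G

  count-nonIsolated : ∀ {u v} → Adj G u v → count (nonIsolated? G) ≤ suc Δ * Δ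
  count-nonIsolated {u} {v} uv =
    decidable-stable (count (nonIsolated? G) ≤? suc Δ * Δ)
      λ ¬bound → independent u v (¬bound ∘ around uv) (¬bound ∘ around (Graph.sym G uv)) uv
    where
    around : ∀ {c c′} → Adj G c c′ → K c → count (nonIsolated? G) ≤ suc Δ * Δ
    around {c} cc′ kc = begin
      count (nonIsolated? G)
        ≤⟨ count-mono (nonIsolated? G) _ (nonIsolated-near kc cc′) ⟩
      count (λ x → any? (λ y → adj? G y x) (c ∷ neighbours G c))
        ≤⟨ count-Any (adj? G) (degree≤maxDegree G) (c ∷ neighbours G c) ⟩
      suc (degree G c) * Δ
        ≤⟨ *-monoˡ-≤ Δ (s≤s (degree≤maxDegree G c)) ⟩
      suc Δ * Δ ∎
      where open ≤-Reasoning

  bandwidth≤Δ[Δ+2] : BandwidthAtMost G (Δ * (Δ + 2))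
  bandwidth≤Δ[Δ+2] = σ , λ u v uv → dist≤ (early uv) (early (Graph.sym G uv))
    where
    σ : Permutation′ (n G)
    σ = proj₁ (moveToFront (nonIsolated? G))
    early : ∀ {u v} → Adj G u v → position σ u ≤ Δ * (Δ + 2)
    early {u} {v} uv = begin
      position σ u            <⟨ proj₂ (moveToFront (nonIsolated? G)) u (v , uv) ⟩
      count (nonIsolated? G)  ≤⟨ count-nonIsolated uv ⟩
      suc Δ * Δ               ≡⟨ *-comm (suc Δ) Δ ⟩
      Δ * suc Δ               ≤⟨ *-monoʳ-≤ Δ (subst (suc Δ ≤_) (+-comm 2 Δ) (n≤1+n (suc Δ))) ⟩
      Δ * (Δ + 2)             ∎
      where open ≤-Reasoning

countBelow : ∀ m {P : Pred ℕ ℓ} → Decidable P → ℕ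
countBelow m P? = count (P? ∘ toℕ {m})

countBelow-≐ : ∀ m {P : Pred ℕ ℓ} {Q : Pred ℕ ℓ′} (P? : Decidable P) (Q? : Decidable Q) →
               P ≐ Q → countBelow m P? ≡ countBelow m Q?
countBelow-≐ m P? Q? (P⊆Q , Q⊆P) = count-≐ (P? ∘ toℕ {m}) (Q? ∘ toℕ) (P⊆Q , Q⊆P)

countBelow-∪ : ∀ m {P : Pred ℕ ℓ} {Q : Pred ℕ ℓ′} (P? : Decidable P) (Q? : Decidable Q) →
               countBelow m (P? ∪? Q?) ≤ countBelow m P? + countBelow m Q?
countBelow-∪ m P? Q? = count-∪ (P? ∘ toℕ {m}) (Q? ∘ toℕ)

InRange : ℕ → ℕ → Pred ℕ 0ℓ
InRange lo l x = lo ≤ x × x < lo + l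

inRange? : ∀ lo l → Decidable (InRange lo l)
inRange? lo l x = lo ≤? x ×-dec x <? lo + l

countBelow-inRange : ∀ m lo l → countBelow m (inRange? lo l) ≡ m ⊓ (lo + l) ∸ lo
countBelow-inRange zero    lo       l       = sym (0∸n≡0 lo)
countBelow-inRange (suc m) (suc lo) l       = begin
  countBelow (suc m) (inRange? (suc lo) l)   ≡⟨ count-reject (inRange? (suc lo) l ∘ toℕ {suc m}) (λ ()) ⟩
  countBelow m (inRange? (suc lo) l ∘ suc)   ≡⟨ countBelow-≐ m (inRange? (suc lo) l ∘ suc) (inRange? lo l) shift ⟩
  countBelow m (inRange? lo l)               ≡⟨ countBelow-inRange m lo l ⟩
  m ⊓ (lo + l) ∸ lo                          ∎
  where
  open ≡-Reasoning
  shift : (InRange (suc lo) l ∘ suc) ≐ InRange lo l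
  shift = (λ { (s≤s i , s≤s j) → i , j }) , (λ (i , j) → s≤s i , s≤s j)
countBelow-inRange (suc m) zero     zero    = begin
  countBelow (suc m) (inRange? 0 0)          ≡⟨ count-reject (inRange? 0 0 ∘ toℕ {suc m}) (λ ()) ⟩
  countBelow m (inRange? 0 0 ∘ suc)          ≡⟨ countBelow-≐ m (inRange? 0 0 ∘ suc) (inRange? 0 0) ((λ ()) , (λ ())) ⟩
  countBelow m (inRange? 0 0)                ≡⟨ countBelow-inRange m 0 0 ⟩
  m ⊓ 0                                      ≡⟨ ⊓-zeroʳ m ⟩
  0                                          ∎
  where open ≡-Reasoning
countBelow-inRange (suc m) zero     (suc l) = begin
  countBelow (suc m) (inRange? 0 (suc l))    ≡⟨ count-accept (inRange? 0 (suc l) ∘ toℕ {suc m}) (z≤n , s≤s z≤n) ⟩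
  suc (countBelow m (inRange? 0 (suc l) ∘ suc)) ≡⟨ cong suc (countBelow-≐ m (inRange? 0 (suc l) ∘ suc) (inRange? 0 l) shift) ⟩
  suc (countBelow m (inRange? 0 l))          ≡⟨ cong suc (countBelow-inRange m 0 l) ⟩
  suc (m ⊓ l)                                ∎
  where
  open ≡-Reasoning
  shift : (InRange 0 (suc l) ∘ suc) ≐ InRange 0 l
  shift = (λ { (_ , s≤s j) → z≤n , j }) , (λ (_ , j) → z≤n , s≤s j)

countBelow-inRange≤ : ∀ m lo l → countBelow m (inRange? lo l) ≤ l
countBelow-inRange≤ m lo l = begin
  countBelow m (inRange? lo l) ≡⟨ countBelow-inRange m lo l ⟩
  m ⊓ (lo + l) ∸ lo            ≤⟨ ∸-monoˡ-≤ lo (m⊓n≤n m (lo + l)) ⟩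
  lo + l ∸ lo                  ≡⟨ m+n∸m≡n lo l ⟩
  l                            ∎
  where open ≤-Reasoning

countBelow-inRange≡ : ∀ m lo l → lo + l ≤ m → countBelow m (inRange? lo l) ≡ l
countBelow-inRange≡ m lo l fits = begin
  countBelow m (inRange? lo l) ≡⟨ countBelow-inRange m lo l ⟩
  m ⊓ (lo + l) ∸ lo            ≡⟨ cong (_∸ lo) (m≥n⇒m⊓n≡n fits) ⟩
  lo + l ∸ lo                  ≡⟨ m+n∸m≡n lo l ⟩
  l                            ∎
  where open ≡-Reasoning

block-of : ∀ b m {lo x} → lo ≤ x → x < lo + m * b → ∃[ h ] h < m × InRange (lo + h * b) b x
block-of b zero    {lo} {x} lo≤x x<lo = ⊥-elim (<⇒≱ (subst (x <_) (+-identityʳ lo) x<lo) lo≤x)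
block-of b (suc m) {lo} {x} lo≤x x<end with x <? lo + b
... | yes x<lo+b = 0 , z<s , subst (λ s → InRange s b x) (sym (+-identityʳ lo)) (lo≤x , x<lo+b)
... | no  x≮lo+b with block-of b m (≮⇒≥ x≮lo+b) (subst (x <_) (sym (+-assoc lo b (m * b))) x<end)
...   | h , h<m , x∈block = suc h , s<s h<m , subst (λ s → InRange s b x) (+-assoc lo b (h * b)) x∈block

-- Hubs are 0 … a - 1; the leaves of hub h are a + h * b … a + h * b + b - 1.
module Corona (p q : ℕ) where

  a b : ℕ
  a = suc p
  b = suc q

  LeafOf : ℕ → ℕ → Set
  LeafOf x h = h < a × InRange (a + h * b) b x

  Adjacent : ℕ → ℕ → Set
  Adjacent x y = (x < a × y < a × x ≢ y) ⊎ LeafOf x y ⊎ LeafOf y x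

  leafOf? : ∀ x h → Dec (LeafOf x h)
  leafOf? x h = h <? a ×-dec inRange? (a + h * b) b x

  adjacent? : ∀ x y → Dec (Adjacent x y)
  adjacent? x y = (x <? a ×-dec y <? a ×-dec ¬? (x ≟ y)) ⊎-dec leafOf? x y ⊎-dec leafOf? y x

  adjacent-sym : ∀ {x y} → Adjacent x y → Adjacent y x
  adjacent-sym (inj₁ (x<a , y<a , x≢y)) = inj₁ (y<a , x<a , x≢y ∘ sym)
  adjacent-sym (inj₂ (inj₁ leaf))        = inj₂ (inj₂ leaf)
  adjacent-sym (inj₂ (inj₂ leaf))        = inj₂ (inj₁ leaf)

  leaf-not-hub : ∀ {x h} → LeafOf x h → ¬ x < a
  leaf-not-hub {h = h} (_ , a+hb≤x , _) x<a = <⇒≱ x<a (≤-trans (m≤m+n a (h * b)) a+hb≤x)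

  adjacent-irrefl : ∀ {x} → ¬ Adjacent x x
  adjacent-irrefl (inj₁ (_ , _ , x≢x))     = x≢x refl
  adjacent-irrefl (inj₂ (inj₁ leaf@(x<a , _))) = leaf-not-hub leaf x<a
  adjacent-irrefl (inj₂ (inj₂ leaf@(x<a , _))) = leaf-not-hub leaf x<a

  graph : Graph
  graph = record
    { n      = a + a * b
    ; Adj    = λ u v → Adjacent (toℕ u) (toℕ v)
    ; adj?   = λ u v → adjacent? (toℕ u) (toℕ v)
    ; sym    = adjacent-sym
    ; irrefl = adjacent-irrefl
    }

  isSplit : IsSplit graph
  isSplit = (λ u → toℕ u < a)
          , (λ u v u<a v<a u≢v → inj₁ (u<a , v<a , u≢v ∘ toℕ-injective))
          , λ u v u≮a v≮a → λ { (inj₁ (u<a , _))        → u≮a u<a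
                              ; (inj₂ (inj₁ (v<a , _))) → v≮a v<a
                              ; (inj₂ (inj₂ (u<a , _))) → u≮a u<a }

  N : ℕ
  N = n graph

  hub-neighbour : ∀ {x y} → x < a → Adjacent x y →
                  (InRange 0 x ∪ InRange (suc x) (p ∸ x) ∪ InRange (a + x * b) b) y
  hub-neighbour {x} {y} x<a (inj₁ (_ , y<a , x≢y)) with <-cmp y x
  ... | tri< y<x _ _ = inj₁ (z≤n , y<x)
  ... | tri≈ _ y≡x _ = ⊥-elim (x≢y (sym y≡x))
  ... | tri> _ _ x<y = inj₂ (inj₁ (x<y , subst (y <_) (sym (cong suc (m+[n∸m]≡n (s≤s⁻¹ x<a)))) y<a))
  hub-neighbour x<a (inj₂ (inj₁ leaf))           = ⊥-elim (leaf-not-hub leaf x<a)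
  hub-neighbour x<a (inj₂ (inj₂ (_ , y∈leaves))) = inj₂ (inj₂ y∈leaves)

  degree-hub : ∀ v → toℕ v < a → degree graph v ≤ p + b
  degree-hub v x<a = begin
    degree graph v
      ≤⟨ count-mono (adj? graph v) ((R₁ ∪? R₂ ∪? R₃) ∘ toℕ) (hub-neighbour x<a) ⟩
    countBelow N (R₁ ∪? R₂ ∪? R₃)
      ≤⟨ countBelow-∪ N R₁ (R₂ ∪? R₃) ⟩
    countBelow N R₁ + countBelow N (R₂ ∪? R₃)
      ≤⟨ +-monoʳ-≤ (countBelow N R₁) (countBelow-∪ N R₂ R₃) ⟩
    countBelow N R₁ + (countBelow N R₂ + countBelow N R₃)
      ≤⟨ +-mono-≤ (countBelow-inRange≤ N 0 x) (+-mono-≤ (countBelow-inRange≤ N (suc x) (p ∸ x)) (countBelow-inRange≤ N (a + x * b) b)) ⟩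
    x + ((p ∸ x) + b)
      ≡⟨ +-assoc x (p ∸ x) b ⟨
    x + (p ∸ x) + b
      ≡⟨ cong (_+ b) (m+[n∸m]≡n (s≤s⁻¹ x<a)) ⟩
    p + b ∎
    where
    open ≤-Reasoning
    x : ℕ
    x = toℕ v
    R₁ : Decidable (InRange 0 x)
    R₁ = inRange? 0 x
    R₂ : Decidable (InRange (suc x) (p ∸ x))
    R₂ = inRange? (suc x) (p ∸ x)
    R₃ : Decidable (InRange (a + x * b) b)
    R₃ = inRange? (a + x * b) b

  leaf-neighbour : ∀ {x y} → ¬ x < a → Adjacent x y → InRange 0 a y
  leaf-neighbour x≮a (inj₁ (x<a , _))        = ⊥-elim (x≮a x<a)
  leaf-neighbour x≮a (inj₂ (inj₁ (y<a , _))) = z≤n , y<a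
  leaf-neighbour x≮a (inj₂ (inj₂ (x<a , _))) = ⊥-elim (x≮a x<a)

  degree-leaf : ∀ v → ¬ toℕ v < a → degree graph v ≤ p + b
  degree-leaf v x≮a = begin
    degree graph v              ≤⟨ count-mono (adj? graph v) (inRange? 0 a ∘ toℕ) (leaf-neighbour x≮a) ⟩
    countBelow N (inRange? 0 a) ≤⟨ countBelow-inRange≤ N 0 a ⟩
    suc p                       ≤⟨ s≤s (m≤m+n p q) ⟩
    suc (p + q)                 ≡⟨ +-suc p q ⟨
    p + b                       ∎
    where open ≤-Reasoning

  hub₀-neighbour : ∀ {y} → InRange 1 (p + b) y → Adjacent 0 y
  hub₀-neighbour {y} (1≤y , y<a+b) with y <? a
  ... | yes y<a = inj₁ (z<s , y<a , λ 0≡y → <-irrefl 0≡y 1≤y)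
  ... | no  y≮a = inj₂ (inj₂ (z<s , subst (λ s → InRange s b y) (sym (+-identityʳ a)) (≮⇒≥ y≮a , y<a+b)))

  degree-hub₀ : p + b ≤ degree graph zero
  degree-hub₀ = begin
    p + b                             ≡⟨ countBelow-inRange≡ N 1 (p + b) fits ⟨
    countBelow N (inRange? 1 (p + b)) ≤⟨ count-mono (inRange? 1 (p + b) ∘ toℕ) (adj? graph zero) hub₀-neighbour ⟩
    degree graph zero                 ∎
    where
    open ≤-Reasoning
    fits : 1 + (p + b) ≤ N
    fits = s≤s (+-monoʳ-≤ p (m≤m+n b (p * b)))

  maxDegree-graph : maxDegree graph ≡ p + b
  maxDegree-graph = ≤-antisym (maxDegree-lub graph degree≤) (≤-trans degree-hub₀ (degree≤maxDegree graph zero))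
    where
    degree≤ : ∀ v → degree graph v ≤ p + b
    degree≤ v = byKind (toℕ v <? a)
      where
      byKind : Dec (toℕ v < a) → degree graph v ≤ p + b
      byKind (yes hub)  = degree-hub v hub
      byKind (no  leaf) = degree-leaf v leaf

  leaf-hub : ∀ u → ¬ toℕ u < a → ∃[ h ] toℕ h < a × Adj graph u h
  leaf-hub u u≮a with block-of b a (≮⇒≥ u≮a) (toℕ<n u)
  ... | h , h<a , u∈leaves = hub , hub<a , inj₂ (inj₁ (hub<a , subst (λ t → InRange (a + t * b) b (toℕ u)) (sym toℕ-hub) u∈leaves))
    where
    hub : Fin N
    hub = fromℕ< (<-≤-trans h<a (m≤m+n a (a * b)))
    toℕ-hub : toℕ hub ≡ h
    toℕ-hub = toℕ-fromℕ< _
    hub<a : toℕ hub < a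
    hub<a = subst (_< a) (sym toℕ-hub) h<a

  hub-near : ∀ u → ∃[ h ] toℕ h < a × ReflClosure (Adj graph) u h
  hub-near u with toℕ u <? a
  ... | yes u<a = u , u<a , refl
  ... | no  u≮a = let (h , h<a , uh) = leaf-hub u u≮a in h , h<a , [ uh ]

  spread : ∀ {k} → BandwidthAtMost graph k → p + a * b ≤ k + k + k
  spread {k} (σ , width) = begin
    p + a * b                             ≡⟨ toℕ-fromℕ (p + a * b) ⟨
    toℕ (fromℕ (p + a * b))               ≡⟨ position-⟨$⟩ˡ σ _ ⟨
    position σ (σ ⟨$⟩ˡ fromℕ (p + a * b)) ≤⟨ SplitGraph.spread≤3k graph isSplit hub-near σ width _ _ ⟩
    position σ (σ ⟨$⟩ˡ zero) + k + k + k  ≡⟨ cong (λ i → i + k + k + k) (position-⟨$⟩ˡ σ zero) ⟩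
    k + k + k                             ∎
    where open ≤-Reasoning

square≤ : ∀ {p b} → p ≤ b → b ≤ suc p → (p + b) * (p + b) ≤ 4 * (p + suc p * b)
square≤ {p} {b} p≤b b≤1+p = begin
  (p + b) * (p + b)         ≤⟨ *-mono-≤ (+-monoˡ-≤ b p≤b) (+-mono-≤ (n≤1+n p) b≤1+p) ⟩
  (b + b) * (suc p + suc p) ≡⟨ twice-product p b ⟩
  4 * (suc p * b)           ≤⟨ *-monoʳ-≤ 4 (m≤n+m (suc p * b) p) ⟩
  4 * (p + suc p * b)       ∎
  where
  open ≤-Reasoning
  twice-product : ∀ p b → (b + b) * (suc p + suc p) ≡ 4 * (suc p * b)
  twice-product = solve-∀

split-graph-with-bandwidth≥Δ²/12 :
  ∀ m → Σ Graph λ G → IsSplit G × maxDegree G ≡ suc m ×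
          ((k : ℕ) → BandwidthAtMost G k → suc m * suc m ≤ 12 * k)
split-graph-with-bandwidth≥Δ²/12 m = graph , isSplit , trans maxDegree-graph p+b≡Δ , λ k bw → begin
  suc m * suc m     ≡⟨ cong (λ Δ → Δ * Δ) p+b≡Δ ⟨
  (p + b) * (p + b) ≤⟨ square≤ (⌊n/2⌋-mono (n≤1+n (suc m))) (s≤s (⌊n/2⌋≤⌈n/2⌉ m)) ⟩
  4 * (p + a * b)   ≤⟨ *-monoʳ-≤ 4 (spread bw) ⟩
  4 * (k + k + k)   ≡⟨ three-times-four k ⟩
  12 * k            ∎
  where
  open ≤-Reasoning
  three-times-four : ∀ k → 4 * (k + k + k) ≡ 12 * k
  three-times-four = solve-∀
  p q : ℕ
  p = ⌈ m /2⌉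
  q = ⌊ m /2⌋
  open Corona p q
  p+b≡Δ : p + b ≡ suc m
  p+b≡Δ = trans (+-suc p q) (cong suc (trans (+-comm p q) (⌊n/2⌋+⌈n/2⌉≡n m)))

lemma11 : ((G : Graph) → IsSplit G →
              BandwidthAtMost G (maxDegree G * (maxDegree G + 2)))
          × ((Δ : ℕ) → 2 ≤ Δ →
              Σ Graph λ G → IsSplit G × maxDegree G ≡ Δ ×
                ((k : ℕ) → BandwidthAtMost G k → Δ * Δ ≤ 12 * k))
lemma11 = SplitGraph.bandwidth≤Δ[Δ+2] , λ { zero () ; (suc m) _ → split-graph-with-bandwidth≥Δ²/12 m }
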